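{- Let $p$ be a prime and $m\ge1$ an integer. Let $\mathbf{A}=(a_{ij})_{1\le i,j\le m}$ and $\mathbf{B}=(b_{ij})_{1\le i,j\le m}$ be given by $$a_{ij}=\begin{cases}(1-p^{ -1})p^{ -|i-j|}, & i\ne j,\\ p^{ -1}\big(p^{ -(i-1)}+p^{i-m}-2\big), & i=j,\end{cases}\qquad b_{ij}=\frac{p^{1-|i-j|}}{p+1-p^{ -(j-1)}-p^{j-m}}-\frac{1}{m(1-p^{ -1})}.$$ If $\mathbf{C}=(c_{ij})$ is a real symmetric $m\times m$ matrix with $\mathbf{A}\mathbf{C}=\mathbf{B}$, then $\mathbf{C}$ is bisymmetric and for all $1\le i,j\le m$, $$c_{ij}=\begin{cases} c_{i1}+c_{mj}-c_{m1}, & i\ge j,\\ c_{im}+c_{1j}-c_{1m}, & i\le j.\end{cases}$$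
   Context: A matrix is bisymmetric if it is symmetric and centrosymmetric, i.e. $c_{ij}=c_{ji}=c_{m+1-i,\,m+1-j}$ for all $i,j$. (In the paper, $\mathbf{C}$ encodes the part $C_{p,m}(x,y)$ of the Green's function on the Tate curve $\mathbb{Q}_p^\times/p^{m\mathbb{Z}}$ depending only on $v_p(x)=i-1$, $v_p(y)=j-1$, and $\mathbf{A}\mathbf{C}=\mathbf{B}$ is the resulting linear system.)
   Formalization: The symmetric matrix $\mathbf{C}$ has rational entries instead of real ones. -}

module Defs where

open import Data.Nat as ℕ using (ℕ; zero; suc; ∣_-_∣; _∸_)
open import Data.Fin using (Fin; toℕ; opposite; fromℕ) renaming (zero to fzero; suc to fsuc)
open import Data.Rational using (ℚ; 0ℚ; 1ℚ; _+_; _*_; _-_; 1/_; ≢-nonZero; _≟_)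
import Data.Rational as Q
open import Data.Integer using (+_)
open import Relation.Nullary using (yes; no)
open import Relation.Binary.PropositionalEquality using (_≡_)

ℕ→ℚ : ℕ → ℚ
ℕ→ℚ n = (+ n) Q./ 1

-- total inverse on ℚ (inv 0 = 0); only ever applied to nonzero values below
inv : ℚ → ℚ
inv q with q ≟ 0ℚ
... | yes _ = 0ℚ
... | no q≢0 = 1/_ q {{≢-nonZero q≢0}}

pinv : ℕ → ℕ → ℚ
pinv p k = inv (ℕ→ℚ (p ℕ.^ k))

-- square matrices of size m (indices Fin m; Fin index k corresponds to paper index k+1)
Mat : ℕ → Set
Mat m = Fin m → Fin m → ℚ

sumFin : ∀ {n} → (Fin n → ℚ) → ℚ
sumFin {zero} f = 0ℚ
sumFin {suc n} f = f fzero + sumFin (λ k → f (fsuc k))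

_·_ : ∀ {m} → Mat m → Mat m → Mat m
(X · Y) i j = sumFin (λ k → X i k * Y k j)

Symmetric : ∀ {m} → Mat m → Set
Symmetric C = ∀ i j → C i j ≡ C j i

Centrosymmetric : ∀ {m} → Mat m → Set
Centrosymmetric C = ∀ i j → C i j ≡ C (opposite i) (opposite j)

Bisymmetric : ∀ {m} → Mat m → Set
Bisymmetric C = Symmetric C × Centrosymmetric C
  where open import Data.Product using (_×_)

-- the matrices A and B of the paper, for m = suc n
-- paper index i corresponds to Fin index with toℕ i = i - 1; m - i = n ∸ toℕ i
matA : (p n : ℕ) → Mat (suc n)
matA p n i j with toℕ i ℕ.≟ toℕ j
... | no _ = (1ℚ - pinv p 1) * pinv p ∣ toℕ i - toℕ j ∣
... | yes _ = pinv p 1 * (pinv p (toℕ i) + pinv p (n ∸ toℕ i) - ℕ→ℚ 2)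

matB : (p n : ℕ) → Mat (suc n)
matB p n i j =
  ℕ→ℚ p * pinv p ∣ toℕ i - toℕ j ∣
    * inv (ℕ→ℚ p + 1ℚ - pinv p (toℕ j) - pinv p (n ∸ toℕ j))
  - inv (ℕ→ℚ (suc n) * (1ℚ - pinv p 1))

{-# OPTIONS --safe #-}
-- A has positive off-diagonal entries and zero row sums, so it obeys a discrete maximum
-- principle: if A x vanishes at a row where x is maximal, x is constant.  Consequently a
-- vector that takes a value c somewhere, and at every row either equals c or is annihilated
-- by A, is identically c.
--
-- A and B are centrosymmetric, so X = C - JCJ (J the reversal permutation) is symmetric
-- with A X = 0.  Its columns, hence X itself, are constant, and X₁₁ = -X_mm forces X = 0.
--
-- For a column j > 1 let d be column j minus column 1 of C.  On the rows i ≥ j, (A d)ᵢ is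
-- γⱼ p^(1-i), and the block of A with rows i ≥ j and columns k < j is the rank-one matrix
-- p^(1-i) (1 - p⁻¹) p^(k-1).  Hence replacing the entries k < j of d by a suitable constant
-- G, and the others by a fixed positive multiple of themselves, gives a vector annihilated
-- by A on the rows i ≥ j; by the maximum principle it equals G, so d is constant on i ≥ j.
-- This is the formula for i ≥ j; the one for i ≤ j follows by centrosymmetry.
module Submission where

open import Defs
open import Data.Nat using (ℕ; suc)
open import Data.Nat.Primality using (Prime)
open import Data.Fin using (Fin; _≤_; opposite) renaming (zero to fzero)
open import Data.Rational using (_+_; _-_)
open import Data.Product using (_×_)
open import Relation.Binary.PropositionalEquality using (_≡_)

open import Algebra.Bundles using (CommutativeRing)
open import Data.Empty using (⊥-elim)
open import Data.Fin.Base using (toℕ; _<_) renaming (suc to fsuc)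
open import Data.Fin.Properties using (_<?_)
import Data.Fin.Properties as Finₚ
import Data.Fin.Permutation as Permutation
import Data.Integer.Base as ℤ
import Data.Integer.Properties as ℤₚ
open import Data.Nat.Base using (zero; _∸_; ∣_-_∣; z≤n; s≤s)
import Data.Nat.Base as ℕ
import Data.Nat.Coprimality as Coprime
open import Data.Nat.Primality using (prime⇒nonTrivial)
import Data.Nat.Properties as ℕₚ
open import Data.Nat.Tactic.RingSolver using () renaming (solve-∀ to ℕ-solve-∀)
open import Data.Product using (Σ-syntax; _,_)
open import Data.Rational.Base using (ℚ; 0ℚ; 1ℚ; _*_; -_; mkℚ; ≢-nonZero)
import Data.Rational.Base as ℚ
import Data.Rational.Properties as ℚₚ
open import Data.Sum.Base using (_⊎_; inj₁; inj₂)
import Data.Sum.Base as Sum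
open import Function.Base using (_∘_)
open import Level using (0ℓ)
open import Relation.Binary.Definitions using (tri<; tri≈; tri>)
open import Relation.Binary.PropositionalEquality
  using (_≢_; ≢-sym; refl; sym; trans; cong; cong₂; subst; subst₂; module ≡-Reasoning)
open import Relation.Nullary using (yes; no)
open import Relation.Nullary.Decidable.Core using (dec⇒maybe)
open import Tactic.RingSolver using (solve-∀)
open import Tactic.RingSolver.Core.AlmostCommutativeRing using (AlmostCommutativeRing; fromCommutativeRing)

open import Algebra.Properties.Group ℚₚ.+-0-group using (x∙y⁻¹≈ε⇒x≈y; x≈y⇒x∙y⁻¹≈ε; ⁻¹-involutive)
open import Algebra.Properties.Semiring.Sum (CommutativeRing.semiring ℚₚ.+-*-commutativeRing)
  using (sum; sum-syntax; sum-cong-≗; ∑-distrib-+; *-distribˡ-sum; *-distribʳ-sum; sum-permute)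

open ≡-Reasoning

-- Without the zero test the solver cannot discard cancelled monomials.
ℚ-ring : AlmostCommutativeRing 0ℓ 0ℓ
ℚ-ring = fromCommutativeRing ℚₚ.+-*-commutativeRing (λ x → dec⇒maybe (0ℚ ℚₚ.≟ x))

ℕ→ℚ≡mkℚ : ∀ n → ℕ→ℚ n ≡ mkℚ (ℤ.+ n) 0 (Coprime.sym (Coprime.1-coprimeTo n))
ℕ→ℚ≡mkℚ n = ℚₚ.normalize-coprime (Coprime.sym (Coprime.1-coprimeTo n))

ℕ→ℚ-* : ∀ a b → ℕ→ℚ (a ℕ.* b) ≡ ℕ→ℚ a * ℕ→ℚ b
ℕ→ℚ-* a b rewrite ℕ→ℚ≡mkℚ a | ℕ→ℚ≡mkℚ b | sym (ℤₚ.pos-* a b) = refl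

ℕ→ℚ-pos : ∀ {n} → 0 ℕ.< n → 0ℚ ℚ.< ℕ→ℚ n
ℕ→ℚ-pos {suc n} _ = ℚₚ.positive⁻¹ _ {{ℚₚ.normalize-pos (suc n) 1}}

ℕ→ℚ-1< : ∀ {n} → 1 ℕ.< n → 1ℚ ℚ.< ℕ→ℚ n
ℕ→ℚ-1< {n} 1<n rewrite ℕ→ℚ≡mkℚ n =
  ℚ.*<* (subst (ℤ._<_ (ℤ.+ 1)) (sym (ℤₚ.*-identityʳ (ℤ.+ n))) (ℤ.+<+ 1<n))

*-pos : ∀ {a b} → 0ℚ ℚ.< a → 0ℚ ℚ.< b → 0ℚ ℚ.< a * b
*-pos {a} {b} 0<a 0<b = ℚₚ.positive⁻¹ _ {{ℚₚ.pos*pos⇒pos a {{ℚ.positive 0<a}} b {{ℚ.positive 0<b}}}}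

*-nonneg : ∀ {a b} → 0ℚ ℚ.≤ a → 0ℚ ℚ.≤ b → 0ℚ ℚ.≤ a * b
*-nonneg {a} {b} 0≤a 0≤b =
  ℚₚ.nonNegative⁻¹ _ {{ℚₚ.nonNeg*nonNeg⇒nonNeg a {{ℚ.nonNegative 0≤a}} b {{ℚ.nonNegative 0≤b}}}}

*-cancelˡ-pos : ∀ {c a b} → 0ℚ ℚ.< c → c * a ≡ c * b → a ≡ b
*-cancelˡ-pos {c} 0<c ca≡cb = ℚₚ.≤-antisym
  (ℚₚ.*-cancelˡ-≤-pos c {{ℚ.positive 0<c}} (ℚₚ.≤-reflexive ca≡cb))
  (ℚₚ.*-cancelˡ-≤-pos c {{ℚ.positive 0<c}} (ℚₚ.≤-reflexive (sym ca≡cb)))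

pos*≡0⇒≡0 : ∀ {a b} → 0ℚ ℚ.< a → a * b ≡ 0ℚ → b ≡ 0ℚ
pos*≡0⇒≡0 {a} 0<a ab≡0 = *-cancelˡ-pos 0<a (trans ab≡0 (sym (ℚₚ.*-zeroʳ a)))

≤⇒0≤sub : ∀ {a b} → a ℚ.≤ b → 0ℚ ℚ.≤ b - a
≤⇒0≤sub {a} {b} a≤b = subst (ℚ._≤ b - a) (ℚₚ.+-inverseʳ a) (ℚₚ.+-monoˡ-≤ (- a) a≤b)

sub≡sub⇒≡ : ∀ {a b} → a - b ≡ b - a → a ≡ b
sub≡sub⇒≡ {a} {b} a-b≡b-a = *-cancelˡ-pos (ℕ→ℚ-pos {2} (s≤s z≤n)) (begin
  (1ℚ + 1ℚ) * a        ≡⟨ double a b ⟩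
  (a - b) + (a + b)    ≡⟨ cong (_+ (a + b)) a-b≡b-a ⟩
  (b - a) + (a + b)    ≡⟨ double′ a b ⟩
  (1ℚ + 1ℚ) * b        ∎)
  where
  double : ∀ a b → (1ℚ + 1ℚ) * a ≡ (a - b) + (a + b)
  double = solve-∀ ℚ-ring
  double′ : ∀ a b → (b - a) + (a + b) ≡ (1ℚ + 1ℚ) * b
  double′ = solve-∀ ℚ-ring

inv-inverseʳ : ∀ {q} → 0ℚ ℚ.< q → q * inv q ≡ 1ℚ
inv-inverseʳ {q} 0<q with q ℚₚ.≟ 0ℚ
... | yes q≡0 = ⊥-elim (ℚₚ.<-irrefl (sym q≡0) 0<q)
... | no q≢0  = ℚₚ.*-inverseʳ q {{≢-nonZero q≢0}}

inv-pos : ∀ {q} → 0ℚ ℚ.< q → 0ℚ ℚ.< inv q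
inv-pos {q} 0<q with q ℚₚ.≟ 0ℚ
... | yes q≡0 = ⊥-elim (ℚₚ.<-irrefl (sym q≡0) 0<q)
... | no q≢0  = ℚₚ.positive⁻¹ _ {{ℚₚ.1/pos⇒pos q {{ℚ.positive 0<q}}}}

inv-unique : ∀ {q x} → 0ℚ ℚ.< q → q * x ≡ 1ℚ → inv q ≡ x
inv-unique 0<q qx≡1 = *-cancelˡ-pos 0<q (trans (inv-inverseʳ 0<q) (sym qx≡1))

module Powers {p : ℕ} (1<p : 1 ℕ.< p) where

  pow : ℕ → ℚ
  pow k = ℕ→ℚ (p ℕ.^ k)

  pow-pos : ∀ k → 0ℚ ℚ.< pow k
  pow-pos k = ℕ→ℚ-pos (ℕₚ.m^n>0 p {{ℕ.>-nonZero (ℕₚ.<-trans ℕₚ.0<1+n 1<p)}} k)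

  pow-+ : ∀ a b → pow (a ℕ.+ b) ≡ pow a * pow b
  pow-+ a b = trans (cong ℕ→ℚ (ℕₚ.^-distribˡ-+-* p a b)) (ℕ→ℚ-* (p ℕ.^ a) (p ℕ.^ b))

  pow*pinv≡1 : ∀ k → pow k * pinv p k ≡ 1ℚ
  pow*pinv≡1 k = inv-inverseʳ (pow-pos k)

  pinv-pos : ∀ k → 0ℚ ℚ.< pinv p k
  pinv-pos k = inv-pos (pow-pos k)

  pinv-+ : ∀ a b → pinv p (a ℕ.+ b) ≡ pinv p a * pinv p b
  pinv-+ a b = inv-unique (pow-pos (a ℕ.+ b)) (begin
    pow (a ℕ.+ b) * (pinv p a * pinv p b)     ≡⟨ cong (_* (pinv p a * pinv p b)) (pow-+ a b) ⟩
    pow a * pow b * (pinv p a * pinv p b)     ≡⟨ interchange (pow a) (pow b) (pinv p a) (pinv p b) ⟩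
    pow a * pinv p a * (pow b * pinv p b)     ≡⟨ cong₂ _*_ (pow*pinv≡1 a) (pow*pinv≡1 b) ⟩
    1ℚ * 1ℚ                                   ≡⟨⟩
    1ℚ                                        ∎)
    where
    interchange : ∀ w x y z → w * x * (y * z) ≡ w * y * (x * z)
    interchange = solve-∀ ℚ-ring

  pinv-suc : ∀ k → pinv p (suc k) ≡ pinv p 1 * pinv p k
  pinv-suc = pinv-+ 1

  pinv-∸ : ∀ {a b} → b ℕ.≤ a → pinv p (a ∸ b) ≡ pinv p a * pow b
  pinv-∸ {a} {b} b≤a = inv-unique (pow-pos (a ∸ b)) (begin
    pow (a ∸ b) * (pinv p a * pow b)    ≡⟨ rearrange (pow (a ∸ b)) (pinv p a) (pow b) ⟩
    pow (a ∸ b) * pow b * pinv p a      ≡⟨ cong (_* pinv p a) (sym (pow-+ (a ∸ b) b)) ⟩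
    pow (a ∸ b ℕ.+ b) * pinv p a        ≡⟨ cong (λ e → pow e * pinv p a) (ℕₚ.m∸n+n≡m b≤a) ⟩
    pow a * pinv p a                    ≡⟨ pow*pinv≡1 a ⟩
    1ℚ                                  ∎)
    where
    rearrange : ∀ x y z → x * (y * z) ≡ x * z * y
    rearrange = solve-∀ ℚ-ring

  1-pinv1-pos : 0ℚ ℚ.< 1ℚ - pinv p 1
  1-pinv1-pos = subst (ℚ._< 1ℚ - pinv p 1) (ℚₚ.+-inverseʳ (pinv p 1)) (ℚₚ.+-monoˡ-< (- pinv p 1) pinv1<1)
    where
    pinv1<1 : pinv p 1 ℚ.< 1ℚ
    pinv1<1 = subst₂ ℚ._<_ (ℚₚ.*-identityʳ (pinv p 1)) (trans (ℚₚ.*-comm (pinv p 1) (pow 1)) (pow*pinv≡1 1))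
      (ℚₚ.*-monoʳ-<-pos (pinv p 1) {{ℚ.positive (pinv-pos 1)}}
        (ℕ→ℚ-1< (subst (1 ℕ.<_) (sym (ℕₚ.*-identityʳ p)) 1<p)))

sumFin≡sum : ∀ {n} (f : Fin n → ℚ) → sumFin f ≡ sum f
sumFin≡sum {zero}  f = refl
sumFin≡sum {suc n} f = cong (f fzero +_) (sumFin≡sum (f ∘ fsuc))

∑-neg : ∀ {n} (f : Fin n → ℚ) → ∑[ k < n ] (- f k) ≡ - sum f
∑-neg {zero}  f = refl
∑-neg {suc n} f = trans (cong (- f fzero +_) (∑-neg (f ∘ fsuc))) (sym (ℚₚ.neg-distrib-+ (f fzero) _))

∑-distrib-sub : ∀ {n} (f g : Fin n → ℚ) → ∑[ k < n ] (f k - g k) ≡ sum f - sum g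
∑-distrib-sub f g = trans (∑-distrib-+ f (-_ ∘ g)) (cong (sum f +_) (∑-neg g))

∑-*-distrib-sub : ∀ {n} (a f g : Fin n → ℚ) →
                  ∑[ k < n ] (a k * (f k - g k)) ≡ ∑[ k < n ] (a k * f k) - ∑[ k < n ] (a k * g k)
∑-*-distrib-sub a f g =
  trans (sum-cong-≗ (λ k → distrib (a k) (f k) (g k))) (∑-distrib-sub (λ k → a k * f k) (λ k → a k * g k))
  where
  distrib : ∀ a x y → a * (x - y) ≡ a * x - a * y
  distrib = solve-∀ ℚ-ring

∑-opposite : ∀ {n} (f : Fin n → ℚ) → ∑[ k < n ] f (opposite k) ≡ sum f
∑-opposite f = sym (sum-permute f Permutation.reverse)

∑-telescope : ∀ n (φ : ℕ → ℚ) → ∑[ k < n ] (φ (suc (toℕ k)) - φ (toℕ k)) ≡ φ n - φ 0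
∑-telescope zero    φ = sym (ℚₚ.+-inverseʳ (φ 0))
∑-telescope (suc n) φ = trans (cong ((φ 1 - φ 0) +_) (∑-telescope n (φ ∘ suc))) (chain (φ 0) (φ 1) (φ (suc n)))
  where
  chain : ∀ a b c → (b - a) + (c - b) ≡ c - a
  chain = solve-∀ ℚ-ring

∑-nonneg : ∀ {n} (f : Fin n → ℚ) → (∀ k → 0ℚ ℚ.≤ f k) → 0ℚ ℚ.≤ sum f
∑-nonneg {zero}  f 0≤f = ℚₚ.≤-refl
∑-nonneg {suc n} f 0≤f = ℚₚ.+-mono-≤ (0≤f fzero) (∑-nonneg (f ∘ fsuc) (0≤f ∘ fsuc))

nonneg+nonneg≡0⇒≡0 : ∀ {a b} → 0ℚ ℚ.≤ a → 0ℚ ℚ.≤ b → a + b ≡ 0ℚ → a ≡ 0ℚ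
nonneg+nonneg≡0⇒≡0 {a} 0≤a 0≤b a+b≡0 =
  ℚₚ.≤-antisym (subst₂ ℚ._≤_ (ℚₚ.+-identityʳ a) a+b≡0 (ℚₚ.+-monoʳ-≤ a 0≤b)) 0≤a

∑-nonneg≡0⇒≡0 : ∀ {n} (f : Fin n → ℚ) → (∀ k → 0ℚ ℚ.≤ f k) → sum f ≡ 0ℚ → ∀ k → f k ≡ 0ℚ
∑-nonneg≡0⇒≡0 f 0≤f ∑f≡0 fzero = nonneg+nonneg≡0⇒≡0 (0≤f fzero) (∑-nonneg (f ∘ fsuc) (0≤f ∘ fsuc)) ∑f≡0
∑-nonneg≡0⇒≡0 f 0≤f ∑f≡0 (fsuc k) = ∑-nonneg≡0⇒≡0 (f ∘ fsuc) (0≤f ∘ fsuc) ∑tail≡0 k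
  where
  ∑tail≡0 : sum (f ∘ fsuc) ≡ 0ℚ
  ∑tail≡0 = nonneg+nonneg≡0⇒≡0 (∑-nonneg (f ∘ fsuc) (0≤f ∘ fsuc)) (0≤f fzero)
              (trans (ℚₚ.+-comm _ (f fzero)) ∑f≡0)

maximiser : ∀ {n} (x : Fin (suc n) → ℚ) → Σ[ i ∈ Fin (suc n) ] (∀ k → x k ℚ.≤ x i)
maximiser {zero}  x = fzero , λ { fzero → ℚₚ.≤-refl }
maximiser {suc n} x with maximiser (x ∘ fsuc)
... | i , x≤xᵢ with ℚₚ.≤-total (x fzero) (x (fsuc i))
...   | inj₁ x₀≤xᵢ = fsuc i , λ { fzero → x₀≤xᵢ ; (fsuc k) → x≤xᵢ k }
...   | inj₂ xᵢ≤x₀ = fzero  , λ { fzero → ℚₚ.≤-refl ; (fsuc k) → ℚₚ.≤-trans (x≤xᵢ k) xᵢ≤x₀ }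

module MaximumPrinciple {n : ℕ} (A : Mat (suc n))
  (A-offDiag-pos : ∀ {i k} → i ≢ k → 0ℚ ℚ.< A i k)
  (A-rowSum : ∀ i → sum (A i) ≡ 0ℚ) where

  Harmonic : (Fin (suc n) → ℚ) → Fin (suc n) → Set
  Harmonic x i = ∑[ k < suc n ] (A i k * x k) ≡ 0ℚ

  harmonic-neg : ∀ {x i} → Harmonic x i → Harmonic (-_ ∘ x) i
  harmonic-neg {x} {i} Ax≡0 = begin
    ∑[ k < suc n ] (A i k * - x k)     ≡⟨ sum-cong-≗ (λ k → sym (ℚₚ.neg-distribʳ-* (A i k) (x k))) ⟩
    ∑[ k < suc n ] (- (A i k * x k))   ≡⟨ ∑-neg (λ k → A i k * x k) ⟩
    - ∑[ k < suc n ] (A i k * x k)     ≡⟨ cong -_ Ax≡0 ⟩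
    0ℚ                                 ∎

  harmonic⇒∑-centred≡0 : ∀ {x i} → Harmonic x i → ∑[ k < suc n ] (A i k * (x i - x k)) ≡ 0ℚ
  harmonic⇒∑-centred≡0 {x} {i} Ax≡0 = begin
    ∑[ k < suc n ] (A i k * (x i - x k))                        ≡⟨ ∑-*-distrib-sub (A i) (λ _ → x i) x ⟩
    ∑[ k < suc n ] (A i k * x i) - ∑[ k < suc n ] (A i k * x k) ≡⟨ cong₂ _-_ (sym (*-distribʳ-sum (x i) (A i))) Ax≡0 ⟩
    sum (A i) * x i - 0ℚ                                        ≡⟨ cong (λ s → s * x i - 0ℚ) (A-rowSum i) ⟩
    0ℚ * x i - 0ℚ                                               ≡⟨ cong (_- 0ℚ) (ℚₚ.*-zeroˡ (x i)) ⟩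
    0ℚ                                                          ∎

  harmonic-max⇒const : ∀ {x i} → Harmonic x i → (∀ k → x k ℚ.≤ x i) → ∀ k → x k ≡ x i
  harmonic-max⇒const {x} {i} Ax≡0 x≤xᵢ k with i Finₚ.≟ k
  ... | yes refl = refl
  ... | no i≢k   = sym (x∙y⁻¹≈ε⇒x≈y (x i) (x k) (pos*≡0⇒≡0 (A-offDiag-pos i≢k)
                     (∑-nonneg≡0⇒≡0 (λ k → A i k * (x i - x k)) 0≤term (harmonic⇒∑-centred≡0 {x} Ax≡0) k)))
    where
    0≤term : ∀ k → 0ℚ ℚ.≤ A i k * (x i - x k)
    0≤term k with i Finₚ.≟ k
    ... | yes refl = ℚₚ.≤-reflexive (sym (trans (cong (A i i *_) (ℚₚ.+-inverseʳ (x i))) (ℚₚ.*-zeroʳ (A i i))))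
    ... | no i≢k   = *-nonneg (ℚₚ.<⇒≤ (A-offDiag-pos i≢k)) (≤⇒0≤sub (x≤xᵢ k))

  level-or-harmonic⇒≤ : ∀ {x c o} → (∀ i → x i ≡ c ⊎ Harmonic x i) → x o ≡ c → ∀ k → x k ℚ.≤ c
  level-or-harmonic⇒≤ {x} {c} {o} level-or-harmonic xₒ≡c k with maximiser x
  ... | i , x≤xᵢ with level-or-harmonic i
  ...   | inj₁ xᵢ≡c = subst (x k ℚ.≤_) xᵢ≡c (x≤xᵢ k)
  ...   | inj₂ harm = subst (x k ℚ.≤_) (trans (sym (harmonic-max⇒const harm x≤xᵢ o)) xₒ≡c) (x≤xᵢ k)

  level-or-harmonic⇒const : ∀ {x c o} → (∀ i → x i ≡ c ⊎ Harmonic x i) → x o ≡ c → ∀ k → x k ≡ c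
  level-or-harmonic⇒const {x} {c} level-or-harmonic xₒ≡c k = ℚₚ.≤-antisym
    (level-or-harmonic⇒≤ level-or-harmonic xₒ≡c k)
    (subst₂ ℚ._≤_ (⁻¹-involutive c) (⁻¹-involutive (x k))
      (ℚₚ.neg-antimono-≤ (level-or-harmonic⇒≤ negated (cong -_ xₒ≡c) k)))
    where
    negated : ∀ i → - x i ≡ - c ⊎ Harmonic (-_ ∘ x) i
    negated i with level-or-harmonic i
    ... | inj₁ xᵢ≡c = inj₁ (cong -_ xᵢ≡c)
    ... | inj₂ harm = inj₂ (harmonic-neg {x} harm)

  harmonic⇒const : ∀ {x} → (∀ i → Harmonic x i) → ∀ k → x k ≡ x fzero
  harmonic⇒const {x} harm = level-or-harmonic⇒const {x} (inj₂ ∘ harm) refl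

  centrosymmetric-solution : (∀ i k → A (opposite i) (opposite k) ≡ A i k) →
    ∀ {B C : Mat (suc n)} → (∀ i j → B (opposite i) (opposite j) ≡ B i j) → Symmetric C →
    (∀ i j → ∑[ k < suc n ] (A i k * C k j) ≡ B i j) → Centrosymmetric C
  centrosymmetric-solution A-opp {B} {C} B-opp C-sym AC≡B i j =
    x∙y⁻¹≈ε⇒x≈y (C i j) (C (opposite i) (opposite j)) (trans (X-const i j) X₀₀≡0)
    where
    X : Mat (suc n)
    X k j = C k j - C (opposite k) (opposite j)

    A-reflected-C : ∀ i j → ∑[ k < suc n ] (A i k * C (opposite k) (opposite j)) ≡ B i j
    A-reflected-C i j = begin
      ∑[ k < suc n ] (A i k * C (opposite k) (opposite j))
        ≡⟨ sum-cong-≗ (λ k → cong (_* C (opposite k) (opposite j)) (sym (A-opp i k))) ⟩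
      ∑[ k < suc n ] (A (opposite i) (opposite k) * C (opposite k) (opposite j))
        ≡⟨ ∑-opposite (λ k → A (opposite i) k * C k (opposite j)) ⟩
      ∑[ k < suc n ] (A (opposite i) k * C k (opposite j))
        ≡⟨ AC≡B (opposite i) (opposite j) ⟩
      B (opposite i) (opposite j)
        ≡⟨ B-opp i j ⟩
      B i j ∎

    X-harmonic : ∀ j i → Harmonic (λ k → X k j) i
    X-harmonic j i = begin
      ∑[ k < suc n ] (A i k * X k j)
        ≡⟨ ∑-*-distrib-sub (A i) (λ k → C k j) (λ k → C (opposite k) (opposite j)) ⟩
      ∑[ k < suc n ] (A i k * C k j) - ∑[ k < suc n ] (A i k * C (opposite k) (opposite j))
        ≡⟨ cong₂ _-_ (AC≡B i j) (A-reflected-C i j) ⟩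
      B i j - B i j
        ≡⟨ ℚₚ.+-inverseʳ (B i j) ⟩
      0ℚ ∎

    X-const : ∀ k j → X k j ≡ X fzero fzero
    X-const k j = begin
      X k j          ≡⟨ harmonic⇒const {λ k → X k j} (X-harmonic j) k ⟩
      X fzero j      ≡⟨ cong₂ _-_ (C-sym fzero j) (C-sym (opposite fzero) (opposite j)) ⟩
      X j fzero      ≡⟨ harmonic⇒const {λ k → X k fzero} (X-harmonic fzero) j ⟩
      X fzero fzero  ∎

    X₀₀≡0 : X fzero fzero ≡ 0ℚ
    X₀₀≡0 = x≈y⇒x∙y⁻¹≈ε (sub≡sub⇒≡ {C fzero fzero} {C (opposite fzero) (opposite fzero)}
      (trans (sym (X-const (opposite fzero) (opposite fzero)))
             (cong (λ e → C (opposite fzero) (opposite fzero) - C e e) (Finₚ.opposite-involutive fzero))))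

  module LowerRankOne (ρ σ : Fin (suc n) → ℚ) (σ-pos : ∀ k → 0ℚ ℚ.< σ k)
    (A-lower : ∀ {i k} → k < i → A i k ≡ ρ i * σ k) where

    module Extension {j : Fin (suc n)} (0<j : 0 ℕ.< toℕ j) {d : Fin (suc n) → ℚ} {γ : ℚ}
      (Ad : ∀ {i} → j ≤ i → ∑[ k < suc n ] (A i k * d k) ≡ γ * ρ i) where

      σ< : Fin (suc n) → ℚ
      σ< k with k <? j
      ... | yes _ = σ k
      ... | no _  = 0ℚ

      S P G : ℚ
      S = sum σ<
      P = ∑[ k < suc n ] (σ< k * d k)
      G = P - γ

      -- G is chosen so that, on the rows i ≥ j, (A x)ᵢ = ρ i * S * (γ + G - P) vanishes.
      x : Fin (suc n) → ℚ
      x k with k <? j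
      ... | yes _ = G
      ... | no _  = S * d k

      A*x : ∀ {i} → j ≤ i → ∀ k → A i k * x k ≡ S * (A i k * d k) + ρ i * (σ< k * (G - S * d k))
      A*x {i} j≤i k with k <? j
      ... | yes k<j rewrite A-lower (ℕₚ.<-≤-trans k<j j≤i) = left (ρ i) (σ k) G S (d k)
        where
        left : ∀ r s g t e → r * s * g ≡ t * (r * s * e) + r * (s * (g - t * e))
        left = solve-∀ ℚ-ring
      ... | no _ = right (A i k) S (d k) (ρ i) (G - S * d k)
        where
        right : ∀ a t e r f → a * (t * e) ≡ t * (a * e) + r * (0ℚ * f)
        right = solve-∀ ℚ-ring

      ∑σ<[G-Sd] : ∑[ k < suc n ] (σ< k * (G - S * d k)) ≡ G * S - S * P
      ∑σ<[G-Sd] = begin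
        ∑[ k < suc n ] (σ< k * (G - S * d k))             ≡⟨ sum-cong-≗ (λ k → distrib (σ< k) G S (d k)) ⟩
        ∑[ k < suc n ] (G * σ< k - S * (σ< k * d k))      ≡⟨ ∑-distrib-sub (λ k → G * σ< k) (λ k → S * (σ< k * d k)) ⟩
        ∑[ k < suc n ] (G * σ< k) - ∑[ k < suc n ] (S * (σ< k * d k))
          ≡⟨ sym (cong₂ _-_ (*-distribˡ-sum G σ<) (*-distribˡ-sum S (λ k → σ< k * d k))) ⟩
        G * S - S * P                                     ∎
        where
        distrib : ∀ s g t e → s * (g - t * e) ≡ g * s - t * (s * e)
        distrib = solve-∀ ℚ-ring

      x-harmonic : ∀ {i} → j ≤ i → Harmonic x i
      x-harmonic {i} j≤i = begin
        ∑[ k < suc n ] (A i k * x k)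
          ≡⟨ sum-cong-≗ (A*x j≤i) ⟩
        ∑[ k < suc n ] (S * (A i k * d k) + ρ i * (σ< k * (G - S * d k)))
          ≡⟨ ∑-distrib-+ (λ k → S * (A i k * d k)) (λ k → ρ i * (σ< k * (G - S * d k))) ⟩
        ∑[ k < suc n ] (S * (A i k * d k)) + ∑[ k < suc n ] (ρ i * (σ< k * (G - S * d k)))
          ≡⟨ sym (cong₂ _+_ (*-distribˡ-sum S (λ k → A i k * d k)) (*-distribˡ-sum (ρ i) (λ k → σ< k * (G - S * d k)))) ⟩
        S * ∑[ k < suc n ] (A i k * d k) + ρ i * ∑[ k < suc n ] (σ< k * (G - S * d k))
          ≡⟨ cong₂ (λ a b → S * a + ρ i * b) (Ad j≤i) ∑σ<[G-Sd] ⟩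
        S * (γ * ρ i) + ρ i * (G * S - S * P)
          ≡⟨ cancel S γ (ρ i) P ⟩
        0ℚ ∎
        where
        cancel : ∀ t c r q → t * (c * r) + r * ((q - c) * t - t * q) ≡ 0ℚ
        cancel = solve-∀ ℚ-ring

      x-below : ∀ {k} → k < j → x k ≡ G
      x-below {k} k<j with k <? j
      ... | yes _  = refl
      ... | no k≮j = ⊥-elim (k≮j k<j)

      x-above : ∀ {k} → j ≤ k → x k ≡ S * d k
      x-above {k} j≤k with k <? j
      ... | yes k<j = ⊥-elim (ℕₚ.≤⇒≯ j≤k k<j)
      ... | no _    = refl

      x≡G : ∀ k → x k ≡ G
      x≡G = level-or-harmonic⇒const {x} level-or-harmonic (x-below {fzero} 0<j)
        where
        level-or-harmonic : ∀ i → x i ≡ G ⊎ Harmonic x i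
        level-or-harmonic i = Sum.map (x-below {i}) (x-harmonic {i}) (ℕₚ.<-≤-connex (toℕ i) (toℕ j))

      S-pos : 0ℚ ℚ.< S
      S-pos = subst (0ℚ ℚ.<_) (cong (_+ sum (σ< ∘ fsuc)) (sym (σ<-below {fzero} 0<j)))
                (ℚₚ.+-mono-<-≤ (σ-pos fzero) (∑-nonneg (σ< ∘ fsuc) (0≤σ< ∘ fsuc)))
        where
        σ<-below : ∀ {k} → k < j → σ< k ≡ σ k
        σ<-below {k} k<j with k <? j
        ... | yes _  = refl
        ... | no k≮j = ⊥-elim (k≮j k<j)
        0≤σ< : ∀ k → 0ℚ ℚ.≤ σ< k
        0≤σ< k with k <? j
        ... | yes _ = ℚₚ.<⇒≤ (σ-pos k)
        ... | no _  = ℚₚ.≤-refl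

      S*d≡G : ∀ {i} → j ≤ i → S * d i ≡ G
      S*d≡G {i} j≤i = trans (sym (x-above j≤i)) (x≡G i)

    constant-from : ∀ {j} → 0 ℕ.< toℕ j → ∀ {d γ} →
                    (∀ {i} → j ≤ i → ∑[ k < suc n ] (A i k * d k) ≡ γ * ρ i) →
                    ∀ {i i′} → j ≤ i → j ≤ i′ → d i ≡ d i′
    constant-from 0<j {d} {γ} Ad j≤i j≤i′ = *-cancelˡ-pos S-pos (trans (S*d≡G j≤i) (sym (S*d≡G j≤i′)))
      where open Extension 0<j {d} {γ} Ad

    lower-formula : ∀ {B C : Mat (suc n)} (γ : Fin (suc n) → ℚ) →
      (∀ {i j} → j ≤ i → B i j - B i fzero ≡ γ j * ρ i) →
      (∀ i j → ∑[ k < suc n ] (A i k * C k j) ≡ B i j) →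
      ∀ i j → j ≤ i → C i j ≡ C i fzero + C (opposite fzero) j - C (opposite fzero) fzero
    lower-formula {C = C} _ _ _ i fzero _ = cancel (C i fzero) (C (opposite fzero) fzero)
      where
      cancel : ∀ a b → a ≡ a + b - b
      cancel = solve-∀ ℚ-ring
    lower-formula {C = C} γ B-diff AC≡B i j@(fsuc _) j≤i =
      rearrange (C i j) (C i fzero) (C (opposite fzero) j) (C (opposite fzero) fzero)
        (constant-from (s≤s z≤n) {λ k → C k j - C k fzero} {γ j} A[Cⱼ-C₀] j≤i (Finₚ.≤fromℕ j))
      where
      A[Cⱼ-C₀] : ∀ {i} → j ≤ i → ∑[ k < suc n ] (A i k * (C k j - C k fzero)) ≡ γ j * ρ i
      A[Cⱼ-C₀] {i} j≤i = trans (∑-*-distrib-sub (A i) (λ k → C k j) (λ k → C k fzero))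
        (trans (cong₂ _-_ (AC≡B i j) (AC≡B i fzero)) (B-diff j≤i))
      rearrange : ∀ a b c d → a - b ≡ c - d → a ≡ b + c - d
      rearrange a b c d a-b≡c-d = begin
        a                ≡⟨ split a b ⟩
        (a - b) + b      ≡⟨ cong (_+ b) a-b≡c-d ⟩
        (c - d) + b      ≡⟨ regroup b c d ⟩
        b + c - d        ∎
        where
        split : ∀ a b → a ≡ (a - b) + b
        split = solve-∀ ℚ-ring
        regroup : ∀ b c d → (c - d) + b ≡ b + c - d
        regroup = solve-∀ ℚ-ring

opposite-injective : ∀ {n} {i k : Fin n} → opposite i ≡ opposite k → i ≡ k
opposite-injective {i = i} {k} e =
  trans (sym (Finₚ.opposite-involutive i)) (trans (cong opposite e) (Finₚ.opposite-involutive k))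

opposite-antitone : ∀ {n} {i j : Fin n} → i ≤ j → opposite j ≤ opposite i
opposite-antitone {n} {i} {j} i≤j =
  subst₂ ℕ._≤_ (sym (Finₚ.opposite-prop j)) (sym (Finₚ.opposite-prop i)) (ℕₚ.∸-monoʳ-≤ n (s≤s i≤j))

∣∸-∸∣≡∣-∣ : ∀ {n a b} → a ℕ.≤ n → b ℕ.≤ n → ∣ n ∸ a - n ∸ b ∣ ≡ ∣ a - b ∣
∣∸-∸∣≡∣-∣ {n} {a} {b} a≤n b≤n = begin
  ∣ n ∸ a - n ∸ b ∣                              ≡⟨ sym (ℕₚ.∣m+n-m+o∣≡∣n-o∣ (a ℕ.+ b) (n ∸ a) (n ∸ b)) ⟩
  ∣ a ℕ.+ b ℕ.+ (n ∸ a) - a ℕ.+ b ℕ.+ (n ∸ b) ∣  ≡⟨ cong₂ ∣_-_∣ (shift a b a≤n)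
                                                      (trans (cong (ℕ._+ (n ∸ b)) (ℕₚ.+-comm a b)) (shift b a b≤n)) ⟩
  ∣ n ℕ.+ b - n ℕ.+ a ∣                          ≡⟨ ℕₚ.∣m+n-m+o∣≡∣n-o∣ n b a ⟩
  ∣ b - a ∣                                      ≡⟨ ℕₚ.∣-∣-comm b a ⟩
  ∣ a - b ∣                                      ∎
  where
  shift : ∀ u v → u ℕ.≤ n → u ℕ.+ v ℕ.+ (n ∸ u) ≡ n ℕ.+ v
  shift u v u≤n = trans (swap u v (n ∸ u)) (cong (ℕ._+ v) (ℕₚ.m+[n∸m]≡n u≤n))
    where
    swap : ∀ x y z → x ℕ.+ y ℕ.+ z ≡ x ℕ.+ z ℕ.+ y
    swap = ℕ-solve-∀

centrosymmetric-upper : ∀ {n} {C : Mat (suc n)} → Centrosymmetric C →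
  (∀ i j → j ≤ i → C i j ≡ C i fzero + C (opposite fzero) j - C (opposite fzero) fzero) →
  ∀ i j → i ≤ j → C i j ≡ C i (opposite fzero) + C fzero j - C fzero (opposite fzero)
centrosymmetric-upper {C = C} C-centro C-lower i j i≤j = begin
  C i j
    ≡⟨ C-centro i j ⟩
  C (opposite i) (opposite j)
    ≡⟨ C-lower (opposite i) (opposite j) (opposite-antitone i≤j) ⟩
  C (opposite i) fzero + C (opposite fzero) (opposite j) - C (opposite fzero) fzero
    ≡⟨ cong₂ _-_ (cong₂ _+_ (C-opposite i fzero) (sym (C-centro fzero j))) (C-opposite fzero fzero) ⟩
  C i (opposite fzero) + C fzero j - C fzero (opposite fzero) ∎
  where
  C-opposite : ∀ a b → C (opposite a) b ≡ C a (opposite b)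
  C-opposite a b = trans (C-centro (opposite a) b) (cong (λ e → C e (opposite b)) (Finₚ.opposite-involutive a))

module PaperMatrices {p : ℕ} (1<p : 1 ℕ.< p) (n : ℕ) where
  open Powers 1<p

  r : ℚ
  r = pinv p 1

  toℕ≤n : ∀ (i : Fin (suc n)) → toℕ i ℕ.≤ n
  toℕ≤n i = ℕₚ.≤-pred (Finₚ.toℕ<n i)

  matA-diag : ∀ i → matA p n i i ≡ r * (pinv p (toℕ i) + pinv p (n ∸ toℕ i) - ℕ→ℚ 2)
  matA-diag i with toℕ i ℕₚ.≟ toℕ i
  ... | yes _  = refl
  ... | no i≢i = ⊥-elim (i≢i refl)

  matA-offDiag : ∀ {i k} → i ≢ k → matA p n i k ≡ (1ℚ - r) * pinv p ∣ toℕ i - toℕ k ∣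
  matA-offDiag {i} {k} i≢k with toℕ i ℕₚ.≟ toℕ k
  ... | yes i≡k = ⊥-elim (i≢k (Finₚ.toℕ-injective i≡k))
  ... | no _    = refl

  matA-offDiag-pos : ∀ {i k} → i ≢ k → 0ℚ ℚ.< matA p n i k
  matA-offDiag-pos {i} {k} i≢k =
    subst (0ℚ ℚ.<_) (sym (matA-offDiag i≢k)) (*-pos 1-pinv1-pos (pinv-pos ∣ toℕ i - toℕ k ∣))

  matA-below : ∀ {i k} → k < i → matA p n i k ≡ (1ℚ - r) * pinv p (toℕ i ∸ toℕ k)
  matA-below k<i = trans (matA-offDiag (≢-sym (Finₚ.<⇒≢ k<i)))
    (cong (λ e → (1ℚ - r) * pinv p e) (ℕₚ.m≤n⇒∣n-m∣≡n∸m (ℕₚ.<⇒≤ k<i)))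

  matA-above : ∀ {i k} → i < k → matA p n i k ≡ (1ℚ - r) * pinv p (toℕ k ∸ toℕ i)
  matA-above i<k = trans (matA-offDiag (Finₚ.<⇒≢ i<k))
    (cong (λ e → (1ℚ - r) * pinv p e) (ℕₚ.m≤n⇒∣m-n∣≡n∸m (ℕₚ.<⇒≤ i<k)))

  ρ σ : Fin (suc n) → ℚ
  ρ i = pinv p (toℕ i)
  σ k = (1ℚ - r) * pow (toℕ k)

  σ-pos : ∀ k → 0ℚ ℚ.< σ k
  σ-pos k = *-pos 1-pinv1-pos (pow-pos (toℕ k))

  matA-lower : ∀ {i k} → k < i → matA p n i k ≡ ρ i * σ k
  matA-lower {i} {k} k<i = begin
    matA p n i k                                ≡⟨ matA-below k<i ⟩
    (1ℚ - r) * pinv p (toℕ i ∸ toℕ k)           ≡⟨ cong ((1ℚ - r) *_) (pinv-∸ (ℕₚ.<⇒≤ k<i)) ⟩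
    (1ℚ - r) * (pinv p (toℕ i) * pow (toℕ k))   ≡⟨ swap (1ℚ - r) (pinv p (toℕ i)) (pow (toℕ k)) ⟩
    ρ i * σ k                                   ∎
    where
    swap : ∀ a b c → a * (b * c) ≡ b * (a * c)
    swap = solve-∀ ℚ-ring

  pinv-suc-∸ : ∀ {a b} → b ℕ.≤ a → pinv p (suc a ∸ b) ≡ r * pinv p (a ∸ b)
  pinv-suc-∸ {a} {b} b≤a = trans (cong (pinv p) (ℕₚ.+-∸-assoc 1 b≤a)) (pinv-suc (a ∸ b))

  φ-top : ℕ → ℚ
  φ-top i = pinv p (suc i) + pinv p (suc n ∸ i)

  -- φ i is a primitive of row i of A, so the row sums telescope.
  φ : ℕ → ℕ → ℚ
  φ i k with k ℕₚ.≤? i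
  ... | yes _ = pinv p (suc i ∸ k)
  ... | no _  = φ-top i - pinv p (k ∸ i)

  φ-≤ : ∀ {i k} → k ℕ.≤ i → φ i k ≡ pinv p (suc i ∸ k)
  φ-≤ {i} {k} k≤i with k ℕₚ.≤? i
  ... | yes _  = refl
  ... | no k≰i = ⊥-elim (k≰i k≤i)

  φ-> : ∀ {i k} → i ℕ.< k → φ i k ≡ φ-top i - pinv p (k ∸ i)
  φ-> {i} {k} i<k with k ℕₚ.≤? i
  ... | yes k≤i = ⊥-elim (ℕₚ.<⇒≱ i<k k≤i)
  ... | no _    = refl

  matA-difference-below : ∀ {i k} → k < i → matA p n i k ≡ φ (toℕ i) (suc (toℕ k)) - φ (toℕ i) (toℕ k)
  matA-difference-below {i} {k} k<i = begin
    matA p n i k                                        ≡⟨ matA-below k<i ⟩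
    (1ℚ - r) * pinv p (toℕ i ∸ toℕ k)                   ≡⟨ geometric r (pinv p (toℕ i ∸ toℕ k)) ⟩
    pinv p (toℕ i ∸ toℕ k) - r * pinv p (toℕ i ∸ toℕ k) ≡⟨ sym (cong₂ _-_ (φ-≤ k<i)
                                                             (trans (φ-≤ (ℕₚ.<⇒≤ k<i)) (pinv-suc-∸ (ℕₚ.<⇒≤ k<i)))) ⟩
    φ (toℕ i) (suc (toℕ k)) - φ (toℕ i) (toℕ k)         ∎
    where
    geometric : ∀ r x → (1ℚ - r) * x ≡ x - r * x
    geometric = solve-∀ ℚ-ring

  matA-difference-above : ∀ {i k} → i < k → matA p n i k ≡ φ (toℕ i) (suc (toℕ k)) - φ (toℕ i) (toℕ k)
  matA-difference-above {i} {k} i<k = begin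
    matA p n i k                                        ≡⟨ matA-above i<k ⟩
    (1ℚ - r) * pinv p (toℕ k ∸ toℕ i)                   ≡⟨ geometric r (pinv p (toℕ k ∸ toℕ i)) (φ-top (toℕ i)) ⟩
    (φ-top (toℕ i) - r * pinv p (toℕ k ∸ toℕ i)) - (φ-top (toℕ i) - pinv p (toℕ k ∸ toℕ i))
      ≡⟨ sym (cong₂ _-_ (trans (φ-> (ℕₚ.m<n⇒m<1+n i<k)) (cong (λ e → φ-top (toℕ i) - e) (pinv-suc-∸ (ℕₚ.<⇒≤ i<k))))
                        (φ-> i<k)) ⟩
    φ (toℕ i) (suc (toℕ k)) - φ (toℕ i) (toℕ k)         ∎
    where
    geometric : ∀ r x c → (1ℚ - r) * x ≡ (c - r * x) - (c - x)
    geometric = solve-∀ ℚ-ring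

  matA-difference-diag : ∀ i → matA p n i i ≡ φ (toℕ i) (suc (toℕ i)) - φ (toℕ i) (toℕ i)
  matA-difference-diag i = begin
    matA p n i i
      ≡⟨ matA-diag i ⟩
    r * (pinv p (toℕ i) + pinv p (n ∸ toℕ i) - (1ℚ + 1ℚ))
      ≡⟨ diagonal r (pinv p (toℕ i)) (pinv p (n ∸ toℕ i)) ⟩
    (r * pinv p (toℕ i) + r * pinv p (n ∸ toℕ i) - r) - r
      ≡⟨ sym (cong₂ (λ a b → (a + b - r) - r) (pinv-suc (toℕ i)) (pinv-suc-∸ (toℕ≤n i))) ⟩
    (φ-top (toℕ i) - r) - r
      ≡⟨ sym (cong₂ _-_ (trans (φ-> (ℕₚ.n<1+n (toℕ i))) (cong (λ e → φ-top (toℕ i) - pinv p e) 1+i∸i≡1))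
                        (trans (φ-≤ {toℕ i} ℕₚ.≤-refl) (cong (pinv p) 1+i∸i≡1))) ⟩
    φ (toℕ i) (suc (toℕ i)) - φ (toℕ i) (toℕ i) ∎
    where
    1+i∸i≡1 : suc (toℕ i) ∸ toℕ i ≡ 1
    1+i∸i≡1 = ℕₚ.m+n∸n≡m 1 (toℕ i)
    diagonal : ∀ r a b → r * (a + b - (1ℚ + 1ℚ)) ≡ (r * a + r * b - r) - r
    diagonal = solve-∀ ℚ-ring

  matA-difference : ∀ i k → matA p n i k ≡ φ (toℕ i) (suc (toℕ k)) - φ (toℕ i) (toℕ k)
  matA-difference i k with ℕₚ.<-cmp (toℕ k) (toℕ i)
  ... | tri< k<i _ _ = matA-difference-below k<i
  ... | tri> _ _ i<k = matA-difference-above i<k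
  ... | tri≈ _ k≡i _ with Finₚ.toℕ-injective k≡i
  ...   | refl = matA-difference-diag i

  matA-rowSum : ∀ i → sum (matA p n i) ≡ 0ℚ
  matA-rowSum i = begin
    sum (matA p n i)                                              ≡⟨ sum-cong-≗ (matA-difference i) ⟩
    ∑[ k < suc n ] (φ (toℕ i) (suc (toℕ k)) - φ (toℕ i) (toℕ k))  ≡⟨ ∑-telescope (suc n) (φ (toℕ i)) ⟩
    φ (toℕ i) (suc n) - φ (toℕ i) 0                               ≡⟨ cong₂ _-_ (φ-> {toℕ i} (s≤s (toℕ≤n i))) (φ-≤ {toℕ i} z≤n) ⟩
    (a + b - b) - a                                               ≡⟨ cancel a b ⟩
    0ℚ                                                            ∎
    where
    a = pinv p (suc (toℕ i))
    b = pinv p (suc n ∸ toℕ i)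
    cancel : ∀ a b → (a + b - b) - a ≡ 0ℚ
    cancel = solve-∀ ℚ-ring

  toℕ-opposite : ∀ (i : Fin (suc n)) → toℕ (opposite i) ≡ n ∸ toℕ i
  toℕ-opposite = Finₚ.opposite-prop

  ∣opposite-opposite∣ : ∀ (i k : Fin (suc n)) → ∣ toℕ (opposite i) - toℕ (opposite k) ∣ ≡ ∣ toℕ i - toℕ k ∣
  ∣opposite-opposite∣ i k = trans (cong₂ ∣_-_∣ (toℕ-opposite i) (toℕ-opposite k)) (∣∸-∸∣≡∣-∣ (toℕ≤n i) (toℕ≤n k))

  pinv-opposite : ∀ (i : Fin (suc n)) →
                  pinv p (toℕ (opposite i)) + pinv p (n ∸ toℕ (opposite i)) ≡ pinv p (toℕ i) + pinv p (n ∸ toℕ i)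
  pinv-opposite i = trans (cong₂ (λ a b → pinv p a + pinv p b) (toℕ-opposite i)
    (trans (cong (n ∸_) (toℕ-opposite i)) (ℕₚ.m∸[m∸n]≡n (toℕ≤n i))))
    (ℚₚ.+-comm (pinv p (n ∸ toℕ i)) (pinv p (toℕ i)))

  matA-opposite : ∀ i k → matA p n (opposite i) (opposite k) ≡ matA p n i k
  matA-opposite i k with i Finₚ.≟ k
  ... | yes refl = begin
    matA p n (opposite i) (opposite i)                                         ≡⟨ matA-diag (opposite i) ⟩
    r * (pinv p (toℕ (opposite i)) + pinv p (n ∸ toℕ (opposite i)) - ℕ→ℚ 2)   ≡⟨ cong (λ e → r * (e - ℕ→ℚ 2)) (pinv-opposite i) ⟩
    r * (pinv p (toℕ i) + pinv p (n ∸ toℕ i) - ℕ→ℚ 2)                         ≡⟨ sym (matA-diag i) ⟩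
    matA p n i i                                                               ∎
  ... | no i≢k = begin
    matA p n (opposite i) (opposite k)                           ≡⟨ matA-offDiag (i≢k ∘ opposite-injective) ⟩
    (1ℚ - r) * pinv p ∣ toℕ (opposite i) - toℕ (opposite k) ∣    ≡⟨ cong (λ e → (1ℚ - r) * pinv p e) (∣opposite-opposite∣ i k) ⟩
    (1ℚ - r) * pinv p ∣ toℕ i - toℕ k ∣                          ≡⟨ sym (matA-offDiag i≢k) ⟩
    matA p n i k                                                 ∎

  scale : Fin (suc n) → ℚ
  scale j = inv (ℕ→ℚ p + 1ℚ - pinv p (toℕ j) - pinv p (n ∸ toℕ j))

  offset : ℚ
  offset = inv (ℕ→ℚ (suc n) * (1ℚ - pinv p 1))

  matB-opposite : ∀ i j → matB p n (opposite i) (opposite j) ≡ matB p n i j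
  matB-opposite i j = cong₂ (λ e s → ℕ→ℚ p * pinv p e * s - offset) (∣opposite-opposite∣ i j) (cong inv denominator)
    where
    denominator : ℕ→ℚ p + 1ℚ - pinv p (toℕ (opposite j)) - pinv p (n ∸ toℕ (opposite j))
                  ≡ ℕ→ℚ p + 1ℚ - pinv p (toℕ j) - pinv p (n ∸ toℕ j)
    denominator = trans (sub-sub (ℕ→ℚ p + 1ℚ) _ _)
      (trans (cong (λ e → ℕ→ℚ p + 1ℚ - e) (pinv-opposite j)) (sym (sub-sub (ℕ→ℚ p + 1ℚ) _ _)))
      where
      sub-sub : ∀ a b c → a - b - c ≡ a - (b + c)
      sub-sub = solve-∀ ℚ-ring

  γ : Fin (suc n) → ℚ
  γ j = ℕ→ℚ p * pow (toℕ j) * scale j - ℕ→ℚ p * pow 0 * scale fzero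

  matB-lower : ∀ {i j} → j ≤ i → matB p n i j ≡ ℕ→ℚ p * (ρ i * pow (toℕ j)) * scale j - offset
  matB-lower {i} {j} j≤i = cong (λ e → ℕ→ℚ p * e * scale j - offset)
    (trans (cong (pinv p) (ℕₚ.m≤n⇒∣n-m∣≡n∸m j≤i)) (pinv-∸ j≤i))

  matB-column-difference : ∀ {i j} → j ≤ i → matB p n i j - matB p n i fzero ≡ γ j * ρ i
  matB-column-difference {i} {j} j≤i = begin
    matB p n i j - matB p n i fzero
      ≡⟨ cong₂ _-_ (matB-lower j≤i) (matB-lower {i} {fzero} z≤n) ⟩
    (ℕ→ℚ p * (ρ i * pow (toℕ j)) * scale j - offset) - (ℕ→ℚ p * (ρ i * pow 0) * scale fzero - offset)
      ≡⟨ factor (ℕ→ℚ p) (ρ i) (pow (toℕ j)) (scale j) (pow 0) (scale fzero) offset ⟩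
    γ j * ρ i ∎
    where
    factor : ∀ q ρ a s b t y → (q * (ρ * a) * s - y) - (q * (ρ * b) * t - y) ≡ (q * a * s - q * b * t) * ρ
    factor = solve-∀ ℚ-ring

mainTheorem10 : (p n : ℕ) → Prime p → (C : Mat (suc n)) → Symmetric C →
    (∀ i j → (matA p n · C) i j ≡ matB p n i j) →
    Bisymmetric C ×
    ((i j : Fin (suc n)) →
      (j ≤ i → C i j ≡ C i fzero + C (opposite fzero) j - C (opposite fzero) fzero) ×
      (i ≤ j → C i j ≡ C i (opposite fzero) + C fzero j - C fzero (opposite fzero)))
mainTheorem10 p n p-prime C C-sym AC≡B =
  (C-sym , C-centro) , λ i j → C-lower i j , centrosymmetric-upper C-centro C-lower i j
  where
  open PaperMatrices (ℕ.nonTrivial⇒n>1 p {{prime⇒nonTrivial p-prime}}) n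
  open MaximumPrinciple (matA p n) matA-offDiag-pos matA-rowSum
  open LowerRankOne ρ σ σ-pos matA-lower

  AC≡B′ : ∀ i j → ∑[ k < suc n ] (matA p n i k * C k j) ≡ matB p n i j
  AC≡B′ i j = trans (sym (sumFin≡sum (λ k → matA p n i k * C k j))) (AC≡B i j)

  C-centro : Centrosymmetric C
  C-centro = centrosymmetric-solution matA-opposite matB-opposite C-sym AC≡B′

  C-lower : ∀ i j → j ≤ i → C i j ≡ C i fzero + C (opposite fzero) j - C (opposite fzero) fzero
  C-lower = lower-formula γ matB-column-difference AC≡B′
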